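{- For all reduced sequences $\overline{x},\overline{y},\overline{w}\in\mathsf{rseq}$: $\mathsf{red}(\overline{x}\overline{w})=\mathsf{red}(\overline{y}\overline{w})$ if and only if $\overline{x}=\overline{y}$.
   Context: $\mathsf{seq}$ is the set of finite sequences over $\{l,r,\lambda,\rho,n\}$ (juxtaposition = concatenation, $\varepsilon$ the empty sequence). One-step reduction $\rightsquigarrow'$ is generated by: $\overline{x}l\lambda\overline{y}\rightsquigarrow'\overline{x}\rho\overline{y}$; $\overline{x}r\lambda\overline{y}\rightsquigarrow'\overline{x}\overline{y}$; $\overline{x}\lambda r\overline{y}\rightsquigarrow'\overline{x}\overline{y}$; $\overline{x}\rho r\overline{y}\rightsquigarrow'\overline{x}l\overline{y}$; $\overline{x}nn\overline{y}\rightsquigarrow'\overline{x}\overline{y}$. A sequence is reduced if no step applies; $\mathsf{rseq}$ is the set of reduced sequences. $\rightsquigarrow$ is the reflexive-transitive closure of $\rightsquigarrow'$, and $\mathsf{red}(\overline{z})$ denotes the unique reduced sequence to which $\overline{z}$ reduces. -}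

module Defs where

open import Data.List using (List; []; _∷_; _++_)
open import Data.Product using (_×_)
open import Relation.Nullary using (¬_)
open import Relation.Binary.Construct.Closure.ReflexiveTransitive using (Star)

data Sym : Set where
  l r lam rho n : Sym

-- seq: finite sequences over the alphabet; juxtaposition = _++_, ε = []
Seq : Set
Seq = List Sym

data _⇝′_ : Seq → Seq → Set where
  lλ→ρ : ∀ x y → (x ++ l ∷ lam ∷ y) ⇝′ (x ++ rho ∷ y)
  rλ→ε : ∀ x y → (x ++ r ∷ lam ∷ y) ⇝′ (x ++ y)
  λr→ε : ∀ x y → (x ++ lam ∷ r ∷ y) ⇝′ (x ++ y)
  ρr→l : ∀ x y → (x ++ rho ∷ r ∷ y) ⇝′ (x ++ l ∷ y)
  nn→ε : ∀ x y → (x ++ n ∷ n ∷ y) ⇝′ (x ++ y)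

_⇝_ : Seq → Seq → Set
_⇝_ = Star _⇝′_

Reduced : Seq → Set
Reduced s = ∀ t → ¬ (s ⇝′ t)

-- IsRed z u : u is red(z), i.e. a reduced sequence to which z reduces
IsRed : Seq → Seq → Set
IsRed z u = (z ⇝ u) × Reduced u

{-# OPTIONS --safe #-}
module Submission where

-- Read a word letter by letter onto a stack, contracting whenever the new letter
-- forms a redex with the top. On a reduced word this just reverses it, and every
-- rewrite step leaves the result unchanged, so red(z) is the reversed stack
-- reached from z. Pushing a letter is injective on reduced stacks: r and λ undo
-- each other, n undoes itself, and l, ρ never contract. Hence red(x w) determines
-- the stack reached from reverse x by reading w, and with it x.

open import Defs
open import Data.List using (List; []; _∷_; _++_; [_]; foldl; reverse; _ʳ++_; drop)
open import Data.List.Properties using (foldl-++; ʳ++-defn; reverse-injective)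
open import Data.List.Relation.Unary.Linked using (Linked; []; [-]; _∷_; tail)
open import Data.Empty using (⊥-elim)
open import Data.Product using (_,_)
open import Function using (flip)
open import Relation.Nullary using (¬_; Dec; yes; no)
open import Relation.Binary.PropositionalEquality using (_≡_; refl; sym; trans; cong; subst; module ≡-Reasoning)
open import Relation.Binary.Construct.Closure.ReflexiveTransitive using (ε; _◅_)
open import Function.Bundles using (_⇔_; mk⇔)

variable
  a b : Sym
  s t x y : Seq

data Redex : Sym → Sym → Set where
  lλ : Redex l lam
  rλ : Redex r lam
  λr : Redex lam r
  ρr : Redex rho r
  nn : Redex n n

redex? : ∀ b a → Dec (Redex b a)
redex? b   l   = no λ ()
redex? b   rho = no λ ()
redex? l   lam = yes lλ
redex? r   lam = yes rλ
redex? lam lam = no λ ()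
redex? rho lam = no λ ()
redex? n   lam = no λ ()
redex? l   r   = no λ ()
redex? r   r   = no λ ()
redex? lam r   = yes λr
redex? rho r   = yes ρr
redex? n   r   = no λ ()
redex? l   n   = no λ ()
redex? r   n   = no λ ()
redex? lam n   = no λ ()
redex? rho n   = no λ ()
redex? n   n   = yes nn

reduced⇒¬redex : ∀ x y → Reduced (x ++ b ∷ a ∷ y) → ¬ Redex b a
reduced⇒¬redex x y R lλ = R _ (lλ→ρ x y)
reduced⇒¬redex x y R rλ = R _ (rλ→ε x y)
reduced⇒¬redex x y R λr = R _ (λr→ε x y)
reduced⇒¬redex x y R ρr = R _ (ρr→l x y)
reduced⇒¬redex x y R nn = R _ (nn→ε x y)

-- A stack is a word read backwards: its top is the last letter of the word.
Stack : Set
Stack = List Sym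

ReducedStack : Stack → Set
ReducedStack = Linked (λ a b → ¬ Redex b a)

push : Stack → Sym → Stack
push []      a = [ a ]
push (b ∷ s) a with redex? b a
... | yes lλ = rho ∷ s
... | yes rλ = s
... | yes λr = s
... | yes ρr = l ∷ s
... | yes nn = s
... | no _   = a ∷ b ∷ s

run : Stack → Seq → Stack
run = foldl push

push-free : ∀ s → ¬ Redex b a → push (b ∷ s) a ≡ a ∷ b ∷ s
push-free {b} {a} s ¬p with redex? b a
... | yes p = ⊥-elim (¬p p)
... | no _  = refl

push-top : ∀ {st} → ReducedStack (a ∷ st) → push st a ≡ a ∷ st
push-top [-]      = refl
push-top (¬p ∷ _) = push-free _ ¬p

cons-reduced : ∀ {st} → (∀ {b} → ¬ Redex b a) → ReducedStack st → ReducedStack (a ∷ st)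
cons-reduced inert []      = [-]
cons-reduced inert [-]     = inert ∷ [-]
cons-reduced inert (p ∷ h) = inert ∷ p ∷ h

push-reduced : ∀ a {st} → ReducedStack st → ReducedStack (push st a)
push-reduced a []  = [-]
push-reduced a {b ∷ s} h with redex? b a
... | yes lλ = cons-reduced (λ ()) (tail h)
... | yes rλ = tail h
... | yes λr = tail h
... | yes ρr = cons-reduced (λ ()) (tail h)
... | yes nn = tail h
... | no ¬p  = ¬p ∷ h

run-reduced : ∀ {st} x → ReducedStack st → ReducedStack (run st x)
run-reduced []      h = h
run-reduced (a ∷ x) h = run-reduced x (push-reduced a h)

unpush : Sym → Stack → Stack
unpush l   = drop 1
unpush rho = drop 1
unpush lam = flip push r
unpush r   = flip push lam
unpush n   = flip push n

unpush-push : ∀ a {st} → ReducedStack st → unpush a (push st a) ≡ st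
unpush-push l   {[]}    h = refl
unpush-push l   {_ ∷ _} h = refl
unpush-push rho {[]}    h = refl
unpush-push rho {_ ∷ _} h = refl
unpush-push lam {[]}    h = refl
unpush-push lam {b ∷ s} h with redex? b lam
... | yes lλ = refl
... | yes rλ = push-top h
... | no _   = refl
unpush-push r   {[]}    h = refl
unpush-push r   {b ∷ s} h with redex? b r
... | yes λr = push-top h
... | yes ρr = refl
... | no _   = refl
unpush-push n   {[]}    h = refl
unpush-push n   {b ∷ s} h with redex? b n
... | yes nn = push-top h
... | no _   = refl

push-injective : ∀ a {st st′} → ReducedStack st → ReducedStack st′ →
                 push st a ≡ push st′ a → st ≡ st′
push-injective a h h′ e = trans (sym (unpush-push a h)) (trans (cong (unpush a) e) (unpush-push a h′))

run-injective : ∀ x {st st′} → ReducedStack st → ReducedStack st′ →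
                run st x ≡ run st′ x → st ≡ st′
run-injective []      h h′ e = e
run-injective (a ∷ x) h h′ e =
  push-injective a h h′ (run-injective x (push-reduced a h) (push-reduced a h′) e)

infix 4 _≈_
_≈_ : Seq → Seq → Set
s ≈ t = ∀ {st} → ReducedStack st → run st s ≡ run st t

≈-cong : s ≈ t → ∀ x y → x ++ s ++ y ≈ x ++ t ++ y
≈-cong {s} {t} s≈t x y {st} h = begin
  run st (x ++ s ++ y)      ≡⟨ foldl-++ push st x (s ++ y) ⟩
  run (run st x) (s ++ y)   ≡⟨ foldl-++ push (run st x) s y ⟩
  run (run (run st x) s) y  ≡⟨ cong (flip run y) (s≈t (run-reduced x h)) ⟩
  run (run (run st x) t) y  ≡⟨ foldl-++ push (run st x) t y ⟨
  run (run st x) (t ++ y)   ≡⟨ foldl-++ push st x (t ++ y) ⟨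
  run st (x ++ t ++ y)      ∎
  where open ≡-Reasoning

lλ≈ρ : l ∷ lam ∷ [] ≈ [ rho ]
lλ≈ρ {[]}    _ = refl
lλ≈ρ {_ ∷ _} _ = refl

ρr≈l : rho ∷ r ∷ [] ≈ [ l ]
ρr≈l {[]}    _ = refl
ρr≈l {_ ∷ _} _ = refl

⇝′⇒≈ : s ⇝′ t → s ≈ t
⇝′⇒≈ (lλ→ρ x y) = ≈-cong lλ≈ρ x y
⇝′⇒≈ (rλ→ε x y) = ≈-cong (unpush-push r) x y
⇝′⇒≈ (λr→ε x y) = ≈-cong (unpush-push lam) x y
⇝′⇒≈ (ρr→l x y) = ≈-cong ρr≈l x y
⇝′⇒≈ (nn→ε x y) = ≈-cong (unpush-push n) x y

⇝⇒≈ : s ⇝ t → s ≈ t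
⇝⇒≈ ε       h = refl
⇝⇒≈ (p ◅ q) h = trans (⇝′⇒≈ p h) (⇝⇒≈ q h)

reduced⇒run≡ʳ++ : ∀ st x → Reduced (st ʳ++ x) → run st x ≡ x ʳ++ st
reduced⇒run≡ʳ++ st []      R = refl
-- R serves twice: st ʳ++ a ∷ x and (a ∷ st) ʳ++ x are the same list by computation.
reduced⇒run≡ʳ++ st (a ∷ x) R =
  trans (cong (flip run x) (push-onto st R)) (reduced⇒run≡ʳ++ (a ∷ st) x R)
  where
  push-onto : ∀ st′ → Reduced (st′ ʳ++ a ∷ x) → push st′ a ≡ a ∷ st′
  push-onto []      R = refl
  push-onto (b ∷ s) R = push-free s (reduced⇒¬redex (reverse s) x (subst Reduced (ʳ++-defn s) R))

reverse-reduced : Reduced x → ReducedStack (reverse x)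
reverse-reduced {x} R = subst ReducedStack (reduced⇒run≡ʳ++ [] x R) (run-reduced x [])

isRed⇒run≡reverse : ∀ {z u} → IsRed z u → run [] z ≡ reverse u
isRed⇒run≡reverse {u = u} (z⇝u , R) = trans (⇝⇒≈ z⇝u []) (reduced⇒run≡ʳ++ [] u R)

isRed-++ : ∀ {x} w {u} → Reduced x → IsRed (x ++ w) u → run (reverse x) w ≡ reverse u
isRed-++ {x} w {u} Rx I = begin
  run (reverse x) w   ≡⟨ cong (flip run w) (reduced⇒run≡ʳ++ [] x Rx) ⟨
  run (run [] x) w    ≡⟨ foldl-++ push [] x w ⟨
  run [] (x ++ w)     ≡⟨ isRed⇒run≡reverse I ⟩
  reverse u           ∎
  where open ≡-Reasoning

theorem26 : ∀ (x y w : Seq) → Reduced x → Reduced y → Reduced w →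
    ∀ (u v : Seq) → IsRed (x ++ w) u → IsRed (y ++ w) v →
    (u ≡ v) ⇔ (x ≡ y)
theorem26 x y w Rx Ry _ u v Iu Iv = mk⇔ cancel congruent
  -- w need not be reduced.
  where
  cancel : u ≡ v → x ≡ y
  cancel u≡v = reverse-injective (run-injective w (reverse-reduced Rx) (reverse-reduced Ry) (begin
    run (reverse x) w  ≡⟨ isRed-++ w Rx Iu ⟩
    reverse u          ≡⟨ cong reverse u≡v ⟩
    reverse v          ≡⟨ isRed-++ w Ry Iv ⟨
    run (reverse y) w  ∎))
    where open ≡-Reasoning
  congruent : x ≡ y → u ≡ v
  congruent refl = reverse-injective (trans (sym (isRed⇒run≡reverse Iu)) (isRed⇒run≡reverse Iv))
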